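{- Let $c \neq 0$ be a complex number and $n\in\mathbb{N}$, and let $(p_n(x))_{n\ge 0}$ be the associated sequence for the delta series $f(t)=t e^{c(e^t-1)}$. Then \[ p_n(x)=x\sum_{k=0}^{n-1}\sum_{j=0}^{k}\frac{(-1)^j(nc)^k}{k!}\binom{k}{j}(x+j)^{n-1}. \]
   Context: Let $\mathcal{F}$ be the algebra of formal power series in $t$ over $\mathbb{C}$. For $f(t)=\sum_{k\ge0}\frac{a_k}{k!}t^k\in\mathcal F$ define a linear functional on polynomials by $\langle f(t)\mid x^n\rangle=a_n$ (so $\langle t^k\mid x^n\rangle=n!\delta_{n,k}$). A delta series is $f\in\mathcal F$ with $f(0)=0$ and nonzero coefficient of $t$. The associated sequence for a delta series $f(t)$ is the unique sequence of polynomials $p_n(x)$ ($n\ge 0$, $\deg p_n=n$) with $\langle f(t)^k\mid p_n(x)\rangle=n!\delta_{n,k}$ for all $n,k\ge0$; equivalently, $\sum_{k\ge 0}p_k(x)\frac{t^k}{k!}=e^{x\bar f(t)}$ where $\bar f$ is the compositional inverse of $f$. -}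

module Defs where

open import Level using (_⊔_)
open import Algebra.Bundles using (CommutativeRing)
open import Data.Nat as ℕ using (ℕ; zero; suc; _∸_)
open import Relation.Binary.PropositionalEquality using (_≢_)
open import Relation.Nullary using (yes; no)
open import Data.Product using (_×_)
open import Data.Nat.Properties using (_!≢0)
open import Data.Nat.Combinatorics using (_C_)
open import Data.Fin as Fin using (Fin; toℕ; fromℕ)
open import Data.Vec using (Vec; lookup)
open import Relation.Nullary using (¬_)

module _ {a ℓ} (R : CommutativeRing a ℓ) where
  open CommutativeRing R

  ℕ→R : ℕ → Carrier
  ℕ→R zero    = 0#
  ℕ→R (suc n) = 1# + ℕ→R n

  pow : Carrier → ℕ → Carrier
  pow x zero    = 1#
  pow x (suc n) = x * pow x n

  Σ< : ℕ → (ℕ → Carrier) → Carrier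
  Σ< zero    g = 0#
  Σ< (suc n) g = Σ< n g + g n

  Σ≤ : ℕ → (ℕ → Carrier) → Carrier
  Σ≤ n g = Σ< (suc n) g

  -- A field of characteristic zero structure on R (ℂ is such a field).
  record CharZeroField : Set (a ⊔ ℓ) where
    field
      1≉0       : ¬ (1# ≈ 0#)
      inv       : (x : Carrier) → ¬ (x ≈ 0#) → Carrier
      inv-law   : (x : Carrier) (x≉0 : ¬ (x ≈ 0#)) → x * inv x x≉0 ≈ 1#
      charZero  : (n : ℕ) → n ≢ 0 → ¬ (ℕ→R n ≈ 0#)

  -- Formal power series in t: the coefficient of t^m (ordinary coefficients).
  Series : Set a
  Series = ℕ → Carrier

  _⊛_ : Series → Series → Series
  (u ⊛ v) m = Σ≤ m (λ i → u i * v (m ∸ i))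

  powS : Series → ℕ → Series
  powS u zero    zero    = 1#
  powS u zero    (suc m) = 0#
  powS u (suc k)         = u ⊛ powS u k

  tS : Series → Series
  tS u zero    = 0#
  tS u (suc m) = u m

  -- Polynomials of degree ≤ n as coefficient vectors (coefficient of x^i at i).
  Poly≤ : ℕ → Set a
  Poly≤ n = Vec Carrier (suc n)

  evalP : ∀ {n} → Poly≤ n → Carrier → Carrier
  evalP {n} q x = Σ≤ n (λ i → coeff i * pow x i)
    where
    coeff : ℕ → Carrier
    coeff i with ℕ._<?_ i (suc n)
    ... | yes i<n = lookup q (Fin.fromℕ< i<n)
    ... | no  _   = 0#

  -- The umbral pairing ⟨ g(t) | q(x) ⟩ = Σ_i q_i ⟨ g | x^i ⟩ with
  -- ⟨ g | x^i ⟩ = i! · [t^i] g   (so ⟨ t^k | x^i ⟩ = i! δ_{ik}).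
  ⟨_∣_⟩ : ∀ {n} → Series → Poly≤ n → Carrier
  ⟨_∣_⟩ {n} g q = Σ≤ n (λ i → coeffQ i * (ℕ→R (i ℕ.!) * g i))
    where
    coeffQ : ℕ → Carrier
    coeffQ i with ℕ._<?_ i (suc n)
    ... | yes i<n = lookup q (Fin.fromℕ< i<n)
    ... | no  _   = 0#

  n!δ : ℕ → ℕ → Carrier
  n!δ n k with n ℕ.≟ k
  ... | yes _ = ℕ→R (n ℕ.!)
  ... | no  _ = 0#

  IsAssociatedSequence : Series → ((n : ℕ) → Poly≤ n) → Set ℓ
  IsAssociatedSequence f p =
    ((n : ℕ) → ¬ (lookup (p n) (fromℕ n) ≈ 0#)) ×
    ((n k : ℕ) → ⟨ powS f k ∣ p n ⟩ ≈ n!δ n k)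

  module _ (F : CharZeroField) where
    open CharZeroField F

    invFact : ℕ → Carrier
    invFact k = inv (ℕ→R (k ℕ.!))
                    (charZero (k ℕ.!) (ℕ.≢-nonZero⁻¹ (k ℕ.!) {{k !≢0}}))

    -- exp(u) = Σ_j u^j / j!, for a series u with zero constant term
    expS : Series → Series
    expS u m = Σ≤ m (λ j → invFact j * powS u j m)

    expm1 : Series
    expm1 zero    = 0#
    expm1 (suc m) = invFact (suc m)

    fSeries : Carrier → Series
    fSeries c = tS (expS (λ m → c * expm1 m))

    rhs : Carrier → ℕ → Carrier → Carrier
    rhs c n x = x * Σ< n (λ k → Σ≤ k (λ j →
      pow (- 1#) j * pow (ℕ→R n * c) k * invFact k * ℕ→R (k C j)
        * pow (x + ℕ→R j) (n ∸ 1)))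

-- This is the transfer formula p_n(x) = x B(t) x^{n-1} with B = (t / f)^n =
-- exp (-nc (e^t - 1)), verified directly. Let q be the coefficients of
-- x B(t) x^{n-1}: q_0 = 0 and q_{i+1} = (n-1)!/i! · [t^{n-1-i}] B. For the Euler
-- operator θ = t d/dt and α = c t e^t one has θ f = (1 + α) f and θ B = -n α B, so
-- P_k = f^k B satisfies θ P_k = k (1 + α) P_k - n α P_k; at tⁿ this gives
-- (n - k) [tⁿ] (1 + α) P_k = 0, while ⟨ f^k ∣ q ⟩ = (n-1)! k [tⁿ] (1 + α) P_k.
-- Hence ⟨ f^k ∣ q ⟩ = n! δ_{nk}; as the powers f^k are triangular, these
-- relations determine the coefficients of p_n, which are therefore q. Expanding
-- B = Σ_k (nc)^k (1 - e^t)^k / k! with (1 - e^t)^k = Σ_j (-1)^j C(k,j) e^{jt}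
-- and using the binomial theorem turns x B(t) x^{n-1} into the stated sum.
module Submission where

open import Defs
open import Level using (Level)
open import Algebra.Bundles using (CommutativeRing)
open import Data.Nat using (ℕ; _≤_)
open import Relation.Nullary using (¬_)
open import Data.Nat as ℕ using (zero; suc; _<_; z≤n; s≤s; _∸_; _!)
import Data.Nat.Properties as ℕₚ
open import Data.Nat.Combinatorics using (_C_; nCk+nC[k+1]≡[n+1]C[k+1]; k![n∸k]!∣n!)
open import Data.Nat.Combinatorics.Specification using (nCk≡n!/k![n-k]!; k>n⇒nCk≡0)
open import Data.Nat.DivMod using (m/n*n≡m)
open import Data.Product using (_,_)
open import Data.Sum using (inj₁; inj₂)
open import Data.Empty using (⊥-elim)
open import Relation.Nullary using (yes; no)
open import Relation.Binary.PropositionalEquality as ≡ using (_≡_; _≢_)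
open import Relation.Binary.Definitions using (tri<; tri≈; tri>)
open import Data.Vec using (lookup)
import Data.Fin as Fin

downward-induction : ∀ {p} (P : ℕ → Set p) n →
  (∀ k → k ≤ n → (∀ i → k < i → i ≤ n → P i) → P k) → ∀ k → k ≤ n → P k
downward-induction P n step k k≤n = from-gap n k k≤n (ℕₚ.m≤n+m n k)
  where
  from-gap : ∀ gap k → k ≤ n → n ≤ k ℕ.+ gap → P k
  from-gap zero k k≤n n≤k+0 = step k k≤n (λ i k<i i≤n →
    ⊥-elim (ℕₚ.<-irrefl ≡.refl (ℕₚ.<-≤-trans k<i (ℕₚ.≤-trans i≤n (≡.subst (n ≤_) (ℕₚ.+-identityʳ k) n≤k+0)))))
  from-gap (suc gap) k k≤n n≤k+1+gap = step k k≤n (λ i k<i i≤n → from-gap gap i i≤n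
    (ℕₚ.≤-trans n≤k+1+gap (≡.subst (_≤ i ℕ.+ gap) (≡.sym (ℕₚ.+-suc k gap)) (ℕₚ.+-monoˡ-≤ gap k<i))))

gap : ∀ {m l} → m < l → m ℕ.+ suc (l ∸ suc m) ≡ l
gap {m} m<l = ≡.trans (ℕₚ.+-suc m _) (ℕₚ.m+[n∸m]≡n m<l)

module Theory {a ℓ} (R : CommutativeRing a ℓ) where
  open CommutativeRing R
  open import Relation.Binary.Reasoning.Setoid setoid
  open import Algebra.Properties.Ring ring using (-‿distribˡ-*; -‿distribʳ-*; -1*x≈-x)
  open import Algebra.Properties.Group +-group using (∙-cancelˡ; ∙-cancelʳ)
  open import Algebra.Solver.Ring.NaturalCoefficients.Default commutativeSemiring

  Σ : ℕ → (ℕ → Carrier) → Carrier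
  Σ = Σ< R

  Σ-cong-< : ∀ n {f g : ℕ → Carrier} → (∀ i → i < n → f i ≈ g i) → Σ n f ≈ Σ n g
  Σ-cong-< zero    e = refl
  Σ-cong-< (suc n) e = +-cong (Σ-cong-< n (λ i i<n → e i (ℕₚ.m<n⇒m<1+n i<n))) (e n ℕₚ.≤-refl)

  Σ-cong : ∀ n {f g : ℕ → Carrier} → (∀ i → f i ≈ g i) → Σ n f ≈ Σ n g
  Σ-cong n e = Σ-cong-< n (λ i _ → e i)

  Σ-zero : ∀ n {f : ℕ → Carrier} → (∀ i → i < n → f i ≈ 0#) → Σ n f ≈ 0#
  Σ-zero zero    e = refl
  Σ-zero (suc n) e = trans (+-cong (Σ-zero n (λ i i<n → e i (ℕₚ.m<n⇒m<1+n i<n))) (e n ℕₚ.≤-refl))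
                           (+-identityˡ 0#)

  Σ-+ : ∀ n (f g : ℕ → Carrier) → Σ n (λ i → f i + g i) ≈ Σ n f + Σ n g
  Σ-+ zero    f g = sym (+-identityˡ 0#)
  Σ-+ (suc n) f g = trans (+-cong (Σ-+ n f g) refl)
    (solve 4 (λ A B C D → (A :+ B) :+ (C :+ D) := (A :+ C) :+ (B :+ D)) refl (Σ n f) (Σ n g) (f n) (g n))

  Σ-*ˡ : ∀ n x (f : ℕ → Carrier) → x * Σ n f ≈ Σ n (λ i → x * f i)
  Σ-*ˡ zero    x f = zeroʳ x
  Σ-*ˡ (suc n) x f = trans (distribˡ x (Σ n f) (f n)) (+-cong (Σ-*ˡ n x f) refl)

  Σ-*ʳ : ∀ n x (f : ℕ → Carrier) → Σ n f * x ≈ Σ n (λ i → f i * x)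
  Σ-*ʳ n x f = trans (*-comm _ x) (trans (Σ-*ˡ n x f) (Σ-cong n (λ i → *-comm x (f i))))

  Σ-peel : ∀ n (f : ℕ → Carrier) → Σ (suc n) f ≈ f 0 + Σ n (λ i → f (suc i))
  Σ-peel zero    f = trans (+-identityˡ (f 0)) (sym (+-identityʳ (f 0)))
  Σ-peel (suc n) f = trans (+-cong (Σ-peel n f) refl) (+-assoc _ _ _)

  Σ-extend : ∀ {m n} (f : ℕ → Carrier) → m ≤ n → (∀ i → m ≤ i → i < n → f i ≈ 0#) → Σ m f ≈ Σ n f
  Σ-extend {n = zero}  f z≤n _ = refl
  Σ-extend {m} {suc n} f m≤1+n vanish with ℕₚ.m≤n⇒m<n∨m≡n m≤1+n
  ... | inj₂ ≡.refl = refl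
  ... | inj₁ m<1+n  = begin
    Σ m f            ≈⟨ Σ-extend f m≤n (λ i m≤i i<n → vanish i m≤i (ℕₚ.m<n⇒m<1+n i<n)) ⟩
    Σ n f            ≈⟨ +-identityʳ _ ⟨
    Σ n f + 0#       ≈⟨ +-cong refl (vanish n m≤n ℕₚ.≤-refl) ⟨
    Σ (suc n) f      ∎
    where
    m≤n : m ≤ n
    m≤n = ℕₚ.≤-pred m<1+n

  Σ-swap : ∀ m n (h : ℕ → ℕ → Carrier) → Σ m (λ i → Σ n (h i)) ≈ Σ n (λ j → Σ m (λ i → h i j))
  Σ-swap zero    n h = sym (Σ-zero n (λ _ _ → refl))
  Σ-swap (suc m) n h = trans (+-cong (Σ-swap m n h) refl) (sym (Σ-+ n _ _))

  Σ-reverse : ∀ m (f : ℕ → Carrier) → Σ (suc m) f ≈ Σ (suc m) (λ i → f (m ∸ i))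
  Σ-reverse zero    f = refl
  Σ-reverse (suc m) f = begin
    Σ (suc m) f + f (suc m)                  ≈⟨ +-cong (Σ-reverse m f) refl ⟩
    Σ (suc m) (λ i → f (m ∸ i)) + f (suc m)  ≈⟨ +-comm _ _ ⟩
    f (suc m) + Σ (suc m) (λ i → f (m ∸ i))  ≈⟨ Σ-peel (suc m) (λ i → f (suc m ∸ i)) ⟨
    Σ (suc (suc m)) (λ i → f (suc m ∸ i))    ∎

  Σ-triangle : ∀ m (h : ℕ → ℕ → Carrier) →
    Σ (suc m) (λ i → Σ (suc i) (λ a → h a i)) ≈ Σ (suc m) (λ a → Σ (suc (m ∸ a)) (λ b → h a (a ℕ.+ b)))
  Σ-triangle zero    h = refl
  Σ-triangle (suc m) h = begin
    Σ (suc m) (λ i → Σ (suc i) (λ a → h a i)) + (Σ (suc m) (λ a → h a (suc m)) + h (suc m) (suc m))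
      ≈⟨ +-cong (Σ-triangle m h) refl ⟩
    Rows + (Σ (suc m) (λ a → h a (suc m)) + h (suc m) (suc m))
      ≈⟨ +-assoc _ _ _ ⟨
    (Rows + Σ (suc m) (λ a → h a (suc m))) + h (suc m) (suc m)
      ≈⟨ +-cong (Σ-+ (suc m) _ _) refl ⟨
    Σ (suc m) (λ a → Σ (suc (m ∸ a)) (λ b → h a (a ℕ.+ b)) + h a (suc m)) + h (suc m) (suc m)
      ≈⟨ +-cong (Σ-cong-< (suc m) longer-row) last-row ⟩
    Σ (suc m) (λ a → Σ (suc (suc m ∸ a)) (λ b → h a (a ℕ.+ b)))
      + Σ (suc (suc m ∸ suc m)) (λ b → h (suc m) (suc m ℕ.+ b)) ∎
    where
    Rows : Carrier
    Rows = Σ (suc m) (λ a → Σ (suc (m ∸ a)) (λ b → h a (a ℕ.+ b)))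
    longer-row : ∀ a → a < suc m →
      Σ (suc (m ∸ a)) (λ b → h a (a ℕ.+ b)) + h a (suc m) ≈ Σ (suc (suc m ∸ a)) (λ b → h a (a ℕ.+ b))
    longer-row a a<1+m rewrite ℕₚ.+-∸-assoc 1 (ℕₚ.≤-pred a<1+m) =
      +-cong refl (reflexive (≡.cong (h a) (≡.trans (≡.cong suc (≡.sym (ℕₚ.m+[n∸m]≡n (ℕₚ.≤-pred a<1+m))))
                                               (≡.sym (ℕₚ.+-suc a (m ∸ a))))))
    last-row : h (suc m) (suc m) ≈ Σ (suc (suc m ∸ suc m)) (λ b → h (suc m) (suc m ℕ.+ b))
    last-row rewrite ℕₚ.n∸n≡0 m | ℕₚ.+-identityʳ m = sym (+-identityˡ _)

  Σ-agree-at : ∀ n k {f g : ℕ → Carrier} → k < n → Σ n f ≈ Σ n g →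
               (∀ i → i < n → i ≢ k → f i ≈ g i) → f k ≈ g k
  Σ-agree-at (suc n) k {f} {g} k<1+n sums others with k ℕ.≟ n
  ... | yes ≡.refl = ∙-cancelˡ (Σ n f) (f n) (g n) (begin
          Σ n f + f n  ≈⟨ sums ⟩
          Σ n g + g n  ≈⟨ +-cong rest refl ⟨
          Σ n f + g n  ∎)
    where
    rest : Σ n f ≈ Σ n g
    rest = Σ-cong-< n (λ i i<n → others i (ℕₚ.m<n⇒m<1+n i<n) (λ i≡n → ℕₚ.<-irrefl i≡n i<n))
  ... | no k≢n = Σ-agree-at n k (ℕₚ.≤∧≢⇒< (ℕₚ.≤-pred k<1+n) k≢n)
          (∙-cancelʳ (f n) (Σ n f) (Σ n g) (trans sums (+-cong refl (sym last))))
          (λ i i<n → others i (ℕₚ.m<n⇒m<1+n i<n))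
    where
    last : f n ≈ g n
    last = others n ℕₚ.≤-refl (λ n≡k → k≢n (≡.sym n≡k))

  ι : ℕ → Carrier
  ι = ℕ→R R

  ι-+ : ∀ m n → ι (m ℕ.+ n) ≈ ι m + ι n
  ι-+ zero    n = sym (+-identityˡ _)
  ι-+ (suc m) n = trans (+-cong refl (ι-+ m n)) (sym (+-assoc _ _ _))

  ι-* : ∀ m n → ι (m ℕ.* n) ≈ ι m * ι n
  ι-* zero    n = sym (zeroˡ _)
  ι-* (suc m) n = begin
    ι (n ℕ.+ m ℕ.* n)      ≈⟨ ι-+ n (m ℕ.* n) ⟩
    ι n + ι (m ℕ.* n)      ≈⟨ +-cong (sym (*-identityˡ _)) (ι-* m n) ⟩
    1# * ι n + ι m * ι n   ≈⟨ distribʳ _ _ _ ⟨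
    (1# + ι m) * ι n       ∎

  ι-1 : ι 1 ≈ 1#
  ι-1 = +-identityʳ 1#

  infixr 8 _^_
  _^_ : Carrier → ℕ → Carrier
  _^_ = pow R

  ^-cong : ∀ {x y} k → x ≈ y → x ^ k ≈ y ^ k
  ^-cong zero    e = refl
  ^-cong (suc k) e = *-cong e (^-cong k e)

  1^ : ∀ k → 1# ^ k ≈ 1#
  1^ zero    = refl
  1^ (suc k) = trans (*-identityˡ _) (1^ k)

  Σ-pascal : ∀ k (G : ℕ → Carrier) →
    Σ (suc (suc k)) (λ j → ι (suc k C j) * G j)
      ≈ Σ (suc k) (λ j → ι (k C j) * G j) + Σ (suc k) (λ j → ι (k C j) * G (suc j))
  Σ-pascal k G = begin
    Σ (suc (suc k)) (λ j → ι (suc k C j) * G j)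
      ≈⟨ Σ-peel (suc k) _ ⟩
    ι 1 * G 0 + Σ (suc k) (λ j → ι (suc k C suc j) * G (suc j))
      ≈⟨ +-cong refl (Σ-cong (suc k) split) ⟩
    ι 1 * G 0 + Σ (suc k) (λ j → ι (k C j) * G (suc j) + ι (k C suc j) * G (suc j))
      ≈⟨ +-cong refl (Σ-+ (suc k) _ _) ⟩
    ι 1 * G 0 + (Shifted + (Σ k (λ j → ι (k C suc j) * G (suc j)) + ι (k C suc k) * G (suc k)))
      ≈⟨ +-cong refl (+-cong refl (+-cong refl top-vanishes)) ⟩
    ι 1 * G 0 + (Shifted + (Σ k (λ j → ι (k C suc j) * G (suc j)) + 0#))
      ≈⟨ solve 4 (λ A B C Z → A :+ (B :+ (C :+ Z)) := ((A :+ C) :+ Z) :+ B) refl _ Shifted _ 0# ⟩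
    (ι 1 * G 0 + Σ k (λ j → ι (k C suc j) * G (suc j)) + 0#) + Shifted
      ≈⟨ +-cong (trans (+-identityʳ _) (sym (Σ-peel k _))) refl ⟩
    Σ (suc k) (λ j → ι (k C j) * G j) + Shifted ∎
    where
    Shifted : Carrier
    Shifted = Σ (suc k) (λ j → ι (k C j) * G (suc j))
    split : ∀ j → ι (suc k C suc j) * G (suc j) ≈ ι (k C j) * G (suc j) + ι (k C suc j) * G (suc j)
    split j rewrite ≡.sym (nCk+nC[k+1]≡[n+1]C[k+1] k j) =
      trans (*-cong (ι-+ (k C j) (k C suc j)) refl) (distribʳ _ _ _)
    top-vanishes : ι (k C suc k) * G (suc k) ≈ 0#
    top-vanishes rewrite k>n⇒nCk≡0 (ℕₚ.n<1+n k) = zeroˡ _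

  binomial : ∀ N x y → (x + y) ^ N ≈ Σ (suc N) (λ i → ι (N C i) * x ^ i * y ^ (N ∸ i))
  binomial zero    x y = sym (trans (+-identityˡ _) (trans (*-identityʳ _) (trans (*-identityʳ _) ι-1)))
  binomial (suc N) x y = begin
    (x + y) * (x + y) ^ N                                   ≈⟨ *-cong refl (binomial N x y) ⟩
    (x + y) * Σ (suc N) T                                   ≈⟨ distribʳ _ _ _ ⟩
    x * Σ (suc N) T + y * Σ (suc N) T                       ≈⟨ +-comm _ _ ⟩
    y * Σ (suc N) T + x * Σ (suc N) T                       ≈⟨ +-cong (Σ-*ˡ (suc N) y T) (Σ-*ˡ (suc N) x T) ⟩
    Σ (suc N) (λ i → y * T i) + Σ (suc N) (λ i → x * T i)
      ≈⟨ +-cong (Σ-cong-< (suc N) y-term) (Σ-cong (suc N) x-term) ⟩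
    Σ (suc N) (λ j → ι (N C j) * G j) + Σ (suc N) (λ j → ι (N C j) * G (suc j)) ≈⟨ Σ-pascal N G ⟨
    Σ (suc (suc N)) (λ j → ι (suc N C j) * G j)           ≈⟨ Σ-cong (suc (suc N)) (λ j → sym (*-assoc _ _ _)) ⟩
    Σ (suc (suc N)) (λ i → ι (suc N C i) * x ^ i * y ^ (suc N ∸ i)) ∎
    where
    T : ℕ → Carrier
    T i = ι (N C i) * x ^ i * y ^ (N ∸ i)
    G : ℕ → Carrier
    G j = x ^ j * y ^ (suc N ∸ j)
    y-term : ∀ i → i < suc N → y * T i ≈ ι (N C i) * G i
    y-term i i<1+N rewrite ℕₚ.+-∸-assoc 1 (ℕₚ.≤-pred i<1+N) =
      solve 4 (λ Y C X Z → Y :* (C :* X :* Z) := C :* (X :* (Y :* Z))) refl y (ι (N C i)) (x ^ i) (y ^ (N ∸ i))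
    x-term : ∀ i → x * T i ≈ ι (N C i) * G (suc i)
    x-term i = solve 4 (λ X C P Z → X :* (C :* P :* Z) := C :* ((X :* P) :* Z)) refl x (ι (N C i)) (x ^ i) (y ^ (N ∸ i))

  Ser : Set a
  Ser = Series R

  infix 4 _≋_
  _≋_ : Ser → Ser → Set ℓ
  u ≋ v = ∀ m → u m ≈ v m

  ≋-sym : ∀ {u v} → u ≋ v → v ≋ u
  ≋-sym e m = sym (e m)

  ≋-trans : ∀ {u v w} → u ≋ v → v ≋ w → u ≋ w
  ≋-trans e e′ m = trans (e m) (e′ m)

  infixl 7 _⊙_
  _⊙_ : Ser → Ser → Ser
  _⊙_ = _⊛_ R

  infixr 8 _^ˢ_
  _^ˢ_ : Ser → ℕ → Ser
  _^ˢ_ = powS R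

  infixl 6 _⊕_
  _⊕_ : Ser → Ser → Ser
  (u ⊕ v) m = u m + v m

  infixr 8 _∙_
  _∙_ : Carrier → Ser → Ser
  (x ∙ u) m = x * u m

  δ : Ser
  δ zero    = 1#
  δ (suc m) = 0#

  θ : Ser → Ser
  θ u m = ι m * u m

  ⊙-cong : ∀ {u u′ v v′} → u ≋ u′ → v ≋ v′ → u ⊙ v ≋ u′ ⊙ v′
  ⊙-cong eu ev m = Σ-cong (suc m) (λ i → *-cong (eu i) (ev (m ∸ i)))

  ⊙-congˡ : ∀ {u u′} w → u ≋ u′ → u ⊙ w ≋ u′ ⊙ w
  ⊙-congˡ w e = ⊙-cong {v = w} {v′ = w} e (λ _ → refl)

  ⊙-congʳ : ∀ w {v v′} → v ≋ v′ → w ⊙ v ≋ w ⊙ v′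
  ⊙-congʳ w e = ⊙-cong {u = w} {u′ = w} (λ _ → refl) e

  ⊙-comm : ∀ u v → u ⊙ v ≋ v ⊙ u
  ⊙-comm u v m = begin
    Σ (suc m) (λ i → u i * v (m ∸ i))              ≈⟨ Σ-reverse m _ ⟩
    Σ (suc m) (λ i → u (m ∸ i) * v (m ∸ (m ∸ i)))  ≈⟨ Σ-cong-< (suc m) swap ⟩
    Σ (suc m) (λ i → v i * u (m ∸ i))              ∎
    where
    swap : ∀ i → i < suc m → u (m ∸ i) * v (m ∸ (m ∸ i)) ≈ v i * u (m ∸ i)
    swap i i<1+m rewrite ℕₚ.m∸[m∸n]≡n (ℕₚ.≤-pred i<1+m) = *-comm _ _

  ⊙-assoc : ∀ u v w → (u ⊙ v) ⊙ w ≋ u ⊙ (v ⊙ w)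
  ⊙-assoc u v w m = begin
    Σ (suc m) (λ i → Σ (suc i) (λ a → u a * v (i ∸ a)) * w (m ∸ i))
      ≈⟨ Σ-cong (suc m) (λ i → Σ-*ʳ (suc i) (w (m ∸ i)) _) ⟩
    Σ (suc m) (λ i → Σ (suc i) (λ a → u a * v (i ∸ a) * w (m ∸ i)))
      ≈⟨ Σ-triangle m (λ a i → u a * v (i ∸ a) * w (m ∸ i)) ⟩
    Σ (suc m) (λ a → Σ (suc (m ∸ a)) (λ b → u a * v ((a ℕ.+ b) ∸ a) * w (m ∸ (a ℕ.+ b))))
      ≈⟨ Σ-cong (suc m) (λ a → Σ-cong (suc (m ∸ a)) (λ b → reindex a b)) ⟩
    Σ (suc m) (λ a → Σ (suc (m ∸ a)) (λ b → u a * (v b * w (m ∸ a ∸ b))))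
      ≈⟨ Σ-cong (suc m) (λ a → sym (Σ-*ˡ (suc (m ∸ a)) (u a) _)) ⟩
    Σ (suc m) (λ a → u a * Σ (suc (m ∸ a)) (λ b → v b * w (m ∸ a ∸ b))) ∎
    where
    reindex : ∀ a b → u a * v ((a ℕ.+ b) ∸ a) * w (m ∸ (a ℕ.+ b)) ≈ u a * (v b * w (m ∸ a ∸ b))
    reindex a b rewrite ℕₚ.m+n∸m≡n a b | ℕₚ.∸-+-assoc m a b = *-assoc _ _ _

  ⊙-lcomm : ∀ u v w → u ⊙ (v ⊙ w) ≋ v ⊙ (u ⊙ w)
  ⊙-lcomm u v w = ≋-trans (≋-sym (⊙-assoc u v w)) (≋-trans (⊙-congˡ w (⊙-comm u v)) (⊙-assoc v u w))

  ⊙-distribʳ : ∀ u v w → (u ⊕ v) ⊙ w ≋ u ⊙ w ⊕ v ⊙ w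
  ⊙-distribʳ u v w m = trans (Σ-cong (suc m) (λ i → distribʳ _ _ _)) (Σ-+ (suc m) _ _)

  ⊙-∙ˡ : ∀ x u v → (x ∙ u) ⊙ v ≋ x ∙ (u ⊙ v)
  ⊙-∙ˡ x u v m = trans (Σ-cong (suc m) (λ i → *-assoc _ _ _)) (sym (Σ-*ˡ (suc m) x _))

  ⊙-∙ʳ : ∀ x u v → u ⊙ (x ∙ v) ≋ x ∙ (u ⊙ v)
  ⊙-∙ʳ x u v = ≋-trans (⊙-comm u (x ∙ v)) (≋-trans (⊙-∙ˡ x v u) (λ m → *-cong refl (⊙-comm v u m)))

  ⊙-Σ : ∀ u K (w : ℕ → Ser) → u ⊙ (λ r → Σ K (λ j → w j r)) ≋ (λ r → Σ K (λ j → (u ⊙ w j) r))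
  ⊙-Σ u K w r = trans (Σ-cong (suc r) (λ i → Σ-*ˡ K (u i) _)) (Σ-swap (suc r) K _)

  δ-unitˡ : ∀ v → δ ⊙ v ≋ v
  δ-unitˡ v m = begin
    Σ (suc m) (λ i → δ i * v (m ∸ i))            ≈⟨ Σ-peel m _ ⟩
    1# * v m + Σ m (λ i → 0# * v (m ∸ suc i))    ≈⟨ +-cong (*-identityˡ _) (Σ-zero m (λ i _ → zeroˡ _)) ⟩
    v m + 0#                                     ≈⟨ +-identityʳ _ ⟩
    v m                                          ∎

  ^ˢ-zero : ∀ u → u ^ˢ 0 ≋ δ
  ^ˢ-zero u zero    = refl
  ^ˢ-zero u (suc m) = refl

  θ-δ : θ δ ≋ (λ _ → 0#)
  θ-δ zero    = zeroˡ _
  θ-δ (suc m) = zeroʳ _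

  ^ˢ-cong : ∀ {u v} k → u ≋ v → u ^ˢ k ≋ v ^ˢ k
  ^ˢ-cong {u} {v} zero e m = trans (^ˢ-zero u m) (sym (^ˢ-zero v m))
  ^ˢ-cong (suc k) e = ⊙-cong e (^ˢ-cong k e)

  ^ˢ-∙ : ∀ x u k → (x ∙ u) ^ˢ k ≋ (x ^ k) ∙ (u ^ˢ k)
  ^ˢ-∙ x u zero    zero    = sym (*-identityˡ _)
  ^ˢ-∙ x u zero    (suc m) = sym (zeroʳ _)
  ^ˢ-∙ x u (suc k) m = begin
    ((x ∙ u) ⊙ (x ∙ u) ^ˢ k) m          ≈⟨ ⊙-congʳ (x ∙ u) {v′ = (x ^ k) ∙ (u ^ˢ k)} (^ˢ-∙ x u k) m ⟩
    ((x ∙ u) ⊙ (x ^ k) ∙ (u ^ˢ k)) m   ≈⟨ ⊙-∙ʳ (x ^ k) (x ∙ u) (u ^ˢ k) m ⟩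
    x ^ k * ((x ∙ u) ⊙ u ^ˢ k) m       ≈⟨ *-cong refl (⊙-∙ˡ x u (u ^ˢ k) m) ⟩
    x ^ k * (x * (u ⊙ u ^ˢ k) m)       ≈⟨ solve 3 (λ A B C → A :* (B :* C) := (B :* A) :* C) refl _ _ _ ⟩
    x * x ^ k * (u ⊙ u ^ˢ k) m         ∎

  θ-⊙ : ∀ u v → θ (u ⊙ v) ≋ θ u ⊙ v ⊕ u ⊙ θ v
  θ-⊙ u v m = begin
    ι m * Σ (suc m) (λ i → u i * v (m ∸ i))                 ≈⟨ Σ-*ˡ (suc m) _ _ ⟩
    Σ (suc m) (λ i → ι m * (u i * v (m ∸ i)))               ≈⟨ Σ-cong-< (suc m) split-degree ⟩
    Σ (suc m) (λ i → θ u i * v (m ∸ i) + u i * θ v (m ∸ i)) ≈⟨ Σ-+ (suc m) _ _ ⟩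
    (θ u ⊙ v ⊕ u ⊙ θ v) m                                    ∎
    where
    split-degree : ∀ i → i < suc m → ι m * (u i * v (m ∸ i)) ≈ θ u i * v (m ∸ i) + u i * θ v (m ∸ i)
    split-degree i i<1+m = begin
      ι m * (u i * v (m ∸ i))                ≡⟨ ≡.cong (λ k → ι k * (u i * v (m ∸ i))) (ℕₚ.m+[n∸m]≡n (ℕₚ.≤-pred i<1+m)) ⟨
      ι (i ℕ.+ (m ∸ i)) * (u i * v (m ∸ i))  ≈⟨ *-cong (ι-+ i (m ∸ i)) refl ⟩
      (ι i + ι (m ∸ i)) * (u i * v (m ∸ i))
        ≈⟨ solve 4 (λ A B U V → (A :+ B) :* (U :* V) := (A :* U) :* V :+ U :* (B :* V)) refl (ι i) (ι (m ∸ i)) (u i) (v (m ∸ i)) ⟩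
      θ u i * v (m ∸ i) + u i * θ v (m ∸ i)  ∎

  θ-^ˢ : ∀ u j → θ (u ^ˢ suc j) ≋ ι (suc j) ∙ (θ u ⊙ u ^ˢ j)
  θ-^ˢ u zero m = begin
    θ (u ⊙ u ^ˢ 0) m                              ≈⟨ θ-⊙ u (u ^ˢ 0) m ⟩
    (θ u ⊙ u ^ˢ 0) m + (u ⊙ θ (u ^ˢ 0)) m        ≈⟨ +-cong refl (⊙-congʳ u θ1≋0 m) ⟩
    (θ u ⊙ u ^ˢ 0) m + (u ⊙ (λ _ → 0#)) m        ≈⟨ +-cong refl (Σ-zero (suc m) (λ _ _ → zeroʳ _)) ⟩
    (θ u ⊙ u ^ˢ 0) m + 0#                        ≈⟨ +-identityʳ _ ⟩
    (θ u ⊙ u ^ˢ 0) m                             ≈⟨ trans (*-cong ι-1 refl) (*-identityˡ _) ⟨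
    ι 1 * (θ u ⊙ u ^ˢ 0) m                       ∎
    where
    θ1≋0 : θ (u ^ˢ 0) ≋ (λ _ → 0#)
    θ1≋0 = ≋-trans (λ m → *-cong refl (^ˢ-zero u m)) θ-δ
  θ-^ˢ u (suc j) m = begin
    θ (u ⊙ u ^ˢ suc j) m                                         ≈⟨ θ-⊙ u (u ^ˢ suc j) m ⟩
    (θ u ⊙ u ^ˢ suc j) m + (u ⊙ θ (u ^ˢ suc j)) m               ≈⟨ +-cong refl (⊙-congʳ u {v′ = ι (suc j) ∙ (θ u ⊙ u ^ˢ j)} (θ-^ˢ u j) m) ⟩
    (θ u ⊙ u ^ˢ suc j) m + (u ⊙ (ι (suc j) ∙ (θ u ⊙ u ^ˢ j))) m
      ≈⟨ +-cong refl (trans (⊙-∙ʳ (ι (suc j)) u (θ u ⊙ u ^ˢ j) m) (*-cong refl (⊙-lcomm u (θ u) (u ^ˢ j) m))) ⟩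
    (θ u ⊙ u ^ˢ suc j) m + ι (suc j) * (θ u ⊙ u ^ˢ suc j) m
      ≈⟨ solve 2 (λ X K → X :+ K :* X := (con 1 :+ K) :* X) refl ((θ u ⊙ u ^ˢ suc j) m) (ι (suc j)) ⟩
    (1# + ι (suc j)) * (θ u ⊙ u ^ˢ suc j) m                     ∎

  θ-^ˢ-eigen : ∀ f h → θ f ≋ h ⊙ f → ∀ k → θ (f ^ˢ k) ≋ ι k ∙ (h ⊙ f ^ˢ k)
  θ-^ˢ-eigen f h θf zero m = trans (trans (*-cong refl (^ˢ-zero f m)) (θ-δ m)) (sym (zeroˡ _))
  θ-^ˢ-eigen f h θf (suc k) m = begin
    θ (f ^ˢ suc k) m                         ≈⟨ θ-^ˢ f k m ⟩
    ι (suc k) * (θ f ⊙ f ^ˢ k) m             ≈⟨ *-cong refl (⊙-congˡ (f ^ˢ k) θf m) ⟩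
    ι (suc k) * ((h ⊙ f) ⊙ f ^ˢ k) m         ≈⟨ *-cong refl (⊙-assoc h f (f ^ˢ k) m) ⟩
    ι (suc k) * (h ⊙ f ^ˢ suc k) m           ∎

  ^ˢ-vanish : ∀ u → u 0 ≈ 0# → ∀ j r → r < j → (u ^ˢ j) r ≈ 0#
  ^ˢ-vanish u u₀ (suc j) r r<1+j = Σ-zero (suc r) term
    where
    term : ∀ i → i < suc r → u i * (u ^ˢ j) (r ∸ i) ≈ 0#
    term zero    _       = trans (*-cong u₀ refl) (zeroˡ _)
    term (suc i) 1+i<1+r = trans (*-cong refl (^ˢ-vanish u u₀ j (r ∸ suc i)
      (ℕₚ.<-≤-trans (ℕₚ.∸-monoʳ-< (s≤s z≤n) (ℕₚ.≤-pred 1+i<1+r)) (ℕₚ.≤-pred r<1+j)))) (zeroʳ _)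

  ^ˢ-leading : ∀ u → u 0 ≈ 0# → u 1 ≈ 1# → ∀ k → (u ^ˢ k) k ≈ 1#
  ^ˢ-leading u u₀ u₁ zero    = refl
  ^ˢ-leading u u₀ u₁ (suc k) = begin
    Σ (suc (suc k)) (λ i → u i * (u ^ˢ k) (suc k ∸ i))                       ≈⟨ Σ-peel (suc k) _ ⟩
    u 0 * (u ^ˢ k) (suc k) + Σ (suc k) (λ i → u (suc i) * (u ^ˢ k) (k ∸ i))  ≈⟨ +-cong refl (Σ-peel k _) ⟩
    u 0 * (u ^ˢ k) (suc k) + (u 1 * (u ^ˢ k) k + Σ k (λ i → u (suc (suc i)) * (u ^ˢ k) (k ∸ suc i)))
      ≈⟨ +-cong (trans (*-cong u₀ refl) (zeroˡ _)) (+-cong (*-cong u₁ (^ˢ-leading u u₀ u₁ k)) (Σ-zero k low)) ⟩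
    0# + (1# * 1# + 0#)                                                       ≈⟨ trans (+-identityˡ _) (trans (+-identityʳ _) (*-identityˡ _)) ⟩
    1#                                                                        ∎
    where
    low : ∀ i → i < k → u (suc (suc i)) * (u ^ˢ k) (k ∸ suc i) ≈ 0#
    low i i<k = trans (*-cong refl (^ˢ-vanish u u₀ k (k ∸ suc i) (ℕₚ.∸-monoʳ-< (s≤s z≤n) i<k))) (zeroʳ _)

  ⊙-agree-upto : ∀ v {w w′} m → (∀ r → r ≤ m → w r ≈ w′ r) → (v ⊙ w) m ≈ (v ⊙ w′) m
  ⊙-agree-upto v m agree = Σ-cong (suc m) (λ i → *-cong refl (agree (m ∸ i) (ℕₚ.m∸n≤m m i)))

  ⊙-agree-below : ∀ v {w w′} m → v 0 ≈ 0# → (∀ r → r < m → w r ≈ w′ r) → (v ⊙ w) m ≈ (v ⊙ w′) m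
  ⊙-agree-below v {w} {w′} m v₀ agree = begin
    (v ⊙ w) m                                       ≈⟨ Σ-peel m _ ⟩
    v 0 * w m + Σ m (λ i → v (suc i) * w (m ∸ suc i))    ≈⟨ +-cong (*-cong v₀ refl) (Σ-cong-< m below) ⟩
    0# * w m + Σ m (λ i → v (suc i) * w′ (m ∸ suc i))    ≈⟨ +-cong (trans (zeroˡ _) (sym (zeroˡ _))) refl ⟩
    0# * w′ m + Σ m (λ i → v (suc i) * w′ (m ∸ suc i))   ≈⟨ +-cong (*-cong v₀ refl) refl ⟨
    v 0 * w′ m + Σ m (λ i → v (suc i) * w′ (m ∸ suc i))  ≈⟨ Σ-peel m _ ⟨
    (v ⊙ w′) m                                      ∎
    where
    below : ∀ i → i < m → v (suc i) * w (m ∸ suc i) ≈ v (suc i) * w′ (m ∸ suc i)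
    below i i<m = *-cong refl (agree (m ∸ suc i) (ℕₚ.∸-monoʳ-< (s≤s z≤n) i<m))

  ⊙-vanish : ∀ u v k → (∀ i → i < k → u i ≈ 0#) → ∀ r → r < k → (u ⊙ v) r ≈ 0#
  ⊙-vanish u v k low r r<k = Σ-zero (suc r) (λ i i≤r →
    trans (*-cong (low i (ℕₚ.<-≤-trans i≤r r<k)) refl) (zeroˡ _))

  ⊙-lowest : ∀ u v k → (∀ i → i < k → u i ≈ 0#) → (u ⊙ v) k ≈ u k * v 0
  ⊙-lowest u v k low = begin
    Σ k (λ i → u i * v (k ∸ i)) + u k * v (k ∸ k)  ≈⟨ +-cong (Σ-zero k (λ i i<k → trans (*-cong (low i i<k) refl) (zeroˡ _))) refl ⟩
    0# + u k * v (k ∸ k)                            ≡⟨ ≡.cong (λ j → 0# + u k * v j) (ℕₚ.n∸n≡0 k) ⟩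
    0# + u k * v 0                                  ≈⟨ +-identityˡ _ ⟩
    u k * v 0                                       ∎

  θ-balance : ∀ a P k n → θ P ≋ ι k ∙ ((δ ⊕ a) ⊙ P) ⊕ (- ι n) ∙ (a ⊙ P) →
              ι n * ((δ ⊕ a) ⊙ P) n ≈ ι k * ((δ ⊕ a) ⊙ P) n
  θ-balance a P k n θP = begin
    ι n * ((δ ⊕ a) ⊙ P) n                 ≈⟨ *-cong refl (⊙-distribʳ δ a P n) ⟩
    ι n * ((δ ⊙ P) n + (a ⊙ P) n)         ≈⟨ *-cong refl (+-cong (δ-unitˡ P n) refl) ⟩
    ι n * (P n + (a ⊙ P) n)               ≈⟨ distribˡ _ _ _ ⟩
    θ P n + ι n * (a ⊙ P) n               ≈⟨ +-cong (θP n) refl ⟩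
    ι k * X + - ι n * (a ⊙ P) n + ι n * (a ⊙ P) n     ≈⟨ +-assoc _ _ _ ⟩
    ι k * X + (- ι n * (a ⊙ P) n + ι n * (a ⊙ P) n)   ≈⟨ +-cong refl (+-cong (-‿distribˡ-* _ _) refl) ⟨
    ι k * X + (- (ι n * (a ⊙ P) n) + ι n * (a ⊙ P) n) ≈⟨ +-cong refl (-‿inverseˡ _) ⟩
    ι k * X + 0#                                      ≈⟨ +-identityʳ _ ⟩
    ι k * X                                           ∎
    where
    X : Carrier
    X = ((δ ⊕ a) ⊙ P) n

  t· : Ser → Ser
  t· = tS R

  t·-cong : ∀ {u v} → u ≋ v → t· u ≋ t· v
  t·-cong e zero    = refl
  t·-cong e (suc m) = e m

  ⊙-t· : ∀ u v → u ⊙ t· v ≋ t· (u ⊙ v)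
  ⊙-t· u v zero    = trans (+-identityˡ _) (zeroʳ _)
  ⊙-t· u v (suc m) = begin
    Σ (suc m) (λ i → u i * t· v (suc m ∸ i)) + u (suc m) * t· v (m ∸ m)  ≈⟨ +-cong (Σ-cong-< (suc m) shift) top ⟩
    (u ⊙ v) m + 0#                                                       ≈⟨ +-identityʳ _ ⟩
    (u ⊙ v) m                                                            ∎
    where
    shift : ∀ i → i < suc m → u i * t· v (suc m ∸ i) ≈ u i * v (m ∸ i)
    shift i i<1+m rewrite ℕₚ.+-∸-assoc 1 (ℕₚ.≤-pred i<1+m) = refl
    top : u (suc m) * t· v (m ∸ m) ≈ 0#
    top rewrite ℕₚ.n∸n≡0 m = zeroʳ _

  θ-t· : ∀ v → θ (t· v) ≋ t· (v ⊕ θ v)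
  θ-t· v zero    = zeroˡ _
  θ-t· v (suc m) = trans (distribʳ _ _ _) (+-cong (*-identityˡ _) refl)

  coeff : ∀ {n} → Poly≤ R n → ℕ → Carrier
  coeff {n} q i with i ℕ.<? suc n
  ... | yes i<n = lookup q (Fin.fromℕ< i<n)
  ... | no  _   = 0#

  pairing : ℕ → (ℕ → Carrier) → Ser → Carrier
  pairing n a w = Σ (suc n) (λ i → a i * (ι (i !) * w i))

  -- Defs computes
  -- the coefficients by a local 'with' that cannot be named, so the summands
  -- are matched up pointwise by a 'with' on the same test, their left-hand
  -- sides being left for Agda to infer from the use in the sum.
  mutual
    evalP-coeff : ∀ {n} (q : Poly≤ R n) x → evalP R q x ≈ Σ (suc n) (λ i → coeff q i * x ^ i)
    evalP-coeff {n} q x = Σ-cong (suc n) (evalP-term q x)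

    evalP-term : ∀ {n} (q : Poly≤ R n) x i → _ ≈ coeff q i * x ^ i
    evalP-term {n} q x i with i ℕ.<? suc n
    ... | yes _ = refl
    ... | no  _ = refl

  mutual
    ⟨∣⟩-coeff : ∀ {n} (w : Ser) (q : Poly≤ R n) → ⟨_∣_⟩ R w q ≈ pairing n (coeff q) w
    ⟨∣⟩-coeff {n} w q = Σ-cong (suc n) (⟨∣⟩-term w q)

    ⟨∣⟩-term : ∀ {n} (w : Ser) (q : Poly≤ R n) i → _ ≈ coeff q i * (ι (i !) * w i)
    ⟨∣⟩-term {n} w q i with i ℕ.<? suc n
    ... | yes _ = refl
    ... | no  _ = refl

  module _ (F : CharZeroField R) where
    open CharZeroField F

    *-cancel : ∀ z {x y} → ¬ (z ≈ 0#) → z * x ≈ z * y → x ≈ y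
    *-cancel z {x} {y} z≉0 zx≈zy = begin
      x                    ≈⟨ trans (*-cong (inv-law z z≉0) refl) (*-identityˡ x) ⟨
      z * inv z z≉0 * x    ≈⟨ solve 3 (λ Z I X → Z :* I :* X := I :* (Z :* X)) refl z (inv z z≉0) x ⟩
      inv z z≉0 * (z * x)  ≈⟨ *-cong refl zx≈zy ⟩
      inv z z≉0 * (z * y)  ≈⟨ solve 3 (λ Z I X → Z :* I :* X := I :* (Z :* X)) refl z (inv z z≉0) y ⟨
      z * inv z z≉0 * y    ≈⟨ trans (*-cong (inv-law z z≉0) refl) (*-identityˡ y) ⟩
      y                    ∎

    shifted-multiple : ∀ m d X → ι (m ℕ.+ suc d) * X ≈ ι m * X → X ≈ 0#
    shifted-multiple m d X e = *-cancel (ι (suc d)) (charZero (suc d) (λ ())) (begin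
      ι (suc d) * X  ≈⟨ ∙-cancelˡ (ι m * X) _ _ (begin
          ι m * X + ι (suc d) * X  ≈⟨ distribʳ X _ _ ⟨
          (ι m + ι (suc d)) * X    ≈⟨ *-cong (ι-+ m (suc d)) refl ⟨
          ι (m ℕ.+ suc d) * X      ≈⟨ e ⟩
          ι m * X                  ≈⟨ +-identityʳ _ ⟨
          ι m * X + 0#             ∎) ⟩
      0#             ≈⟨ zeroʳ _ ⟨
      ι (suc d) * 0# ∎)

    distinct-multiples : ∀ n k X → n ≢ k → ι n * X ≈ ι k * X → X ≈ 0#
    distinct-multiples n k X n≢k nX≈kX with ℕₚ.<-cmp n k
    ... | tri< n<k _ _ = shifted-multiple n (k ∸ suc n) X
                           (trans (reflexive (≡.cong (λ l → ι l * X) (gap n<k))) (sym nX≈kX))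
    ... | tri≈ _ n≡k _ = ⊥-elim (n≢k n≡k)
    ... | tri> _ _ k<n = shifted-multiple k (n ∸ suc k) X
                           (trans (reflexive (≡.cong (λ l → ι l * X) (gap k<n))) nX≈kX)

    1/! : ℕ → Carrier
    1/! = invFact R F

    !≉0 : ∀ k → ¬ (ι (k !) ≈ 0#)
    !≉0 k = charZero (k !) (ℕ.≢-nonZero⁻¹ (k !) {{k ℕₚ.!≢0}})

    !*1/! : ∀ k → ι (k !) * 1/! k ≈ 1#
    !*1/! k = inv-law _ _

    1/!-zero : 1/! 0 ≈ 1#
    1/!-zero = *-cancel (ι 1) (!≉0 0) (trans (!*1/! 0) (sym (trans (*-identityʳ _) ι-1)))

    1/!-suc : ∀ k → ι (suc k) * 1/! (suc k) ≈ 1/! k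
    1/!-suc k = *-cancel (ι (k !)) (!≉0 k) (begin
      ι (k !) * (ι (suc k) * 1/! (suc k))  ≈⟨ solve 3 (λ A B C → A :* (B :* C) := (B :* A) :* C) refl (ι (k !)) (ι (suc k)) (1/! (suc k)) ⟩
      ι (suc k) * ι (k !) * 1/! (suc k)    ≈⟨ *-cong (ι-* (suc k) (k !)) refl ⟨
      ι (suc k !) * 1/! (suc k)            ≈⟨ !*1/! (suc k) ⟩
      1#                                   ≈⟨ !*1/! k ⟨
      ι (k !) * 1/! k                      ∎)

    C-factorials : ∀ {N i} → i ≤ N → ι (N C i) ≈ ι (N !) * 1/! i * 1/! (N ∸ i)
    C-factorials {N} {i} i≤N = sym (begin
      ι (N !) * 1/! i * 1/! (N ∸ i)
        ≡⟨ ≡.cong (λ t → ι t * 1/! i * 1/! (N ∸ i)) n!≡C*i!*[N-i]! ⟩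
      ι ((N C i) ℕ.* ((i !) ℕ.* ((N ∸ i) !))) * 1/! i * 1/! (N ∸ i)
        ≈⟨ *-cong (*-cong (trans (ι-* (N C i) _) (*-cong refl (ι-* (i !) _))) refl) refl ⟩
      ι (N C i) * (ι (i !) * ι ((N ∸ i) !)) * 1/! i * 1/! (N ∸ i)
        ≈⟨ solve 5 (λ C A B X Y → C :* (A :* B) :* X :* Y := C :* (A :* X) :* (B :* Y)) refl
             (ι (N C i)) (ι (i !)) (ι ((N ∸ i) !)) (1/! i) (1/! (N ∸ i)) ⟩
      ι (N C i) * (ι (i !) * 1/! i) * (ι ((N ∸ i) !) * 1/! (N ∸ i))
        ≈⟨ *-cong (*-cong refl (!*1/! i)) (!*1/! (N ∸ i)) ⟩
      ι (N C i) * 1# * 1#                                 ≈⟨ trans (*-identityʳ _) (*-identityʳ _) ⟩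
      ι (N C i)                                           ∎)
      where
      n!≡C*i!*[N-i]! : N ! ≡ (N C i) ℕ.* ((i !) ℕ.* ((N ∸ i) !))
      n!≡C*i!*[N-i]! = ≡.sym (≡.trans (≡.cong (ℕ._* ((i !) ℕ.* ((N ∸ i) !))) (nCk≡n!/k![n-k]! i≤N))
                                       (m/n*n≡m {{ℕₚ._!*_!≢0 i (N ∸ i)}} (k![n∸k]!∣n! i≤N)))

    triangular-unique : ∀ (U : ℕ → Ser) → (∀ k i → i < k → U k i ≈ 0#) → (∀ k → U k k ≈ 1#) →
      ∀ n (a b : ℕ → Carrier) → (∀ k → k ≤ n → pairing n a (U k) ≈ pairing n b (U k)) →
      ∀ i → i ≤ n → a i ≈ b i
    triangular-unique U low lead n a b pairings = downward-induction (λ i → a i ≈ b i) n step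
      where
      step : ∀ k → k ≤ n → (∀ i → k < i → i ≤ n → a i ≈ b i) → a k ≈ b k
      step k k≤n above = *-cancel (ι (k !)) (!≉0 k) (begin
        ι (k !) * a k               ≈⟨ diagonal a ⟨
        a k * (ι (k !) * U k k)     ≈⟨ Σ-agree-at (suc n) k (s≤s k≤n) (pairings k k≤n) others ⟩
        b k * (ι (k !) * U k k)     ≈⟨ diagonal b ⟩
        ι (k !) * b k               ∎)
        where
        diagonal : ∀ c → c k * (ι (k !) * U k k) ≈ ι (k !) * c k
        diagonal c = trans (*-cong refl (trans (*-cong refl (lead k)) (*-identityʳ _))) (*-comm _ _)
        others : ∀ i → i < suc n → i ≢ k → a i * (ι (i !) * U k i) ≈ b i * (ι (i !) * U k i)
        others i i<1+n i≢k with ℕₚ.<-cmp i k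
        ... | tri< i<k _ _ = trans (below a) (sym (below b))
          where
          below : ∀ c → c i * (ι (i !) * U k i) ≈ 0#
          below c = trans (*-cong refl (trans (*-cong refl (low k i i<k)) (zeroʳ _))) (zeroʳ _)
        ... | tri≈ _ i≡k _ = ⊥-elim (i≢k i≡k)
        ... | tri> _ _ k<i = *-cong (above i k<i (ℕₚ.≤-pred i<1+n)) refl

    exp : Ser → Ser
    exp = expS R F

    exp< : ℕ → Ser → Ser
    exp< M u r = Σ M (λ j → 1/! j * (u ^ˢ j) r)

    exp-zero : ∀ u → exp u 0 ≈ 1#
    exp-zero u = trans (+-identityˡ _) (trans (*-identityʳ _) 1/!-zero)

    exp-truncate : ∀ u → u 0 ≈ 0# → ∀ M r → r < M → exp u r ≈ exp< M u r
    exp-truncate u u₀ M r r<M = Σ-extend _ r<M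
      (λ j r<j _ → trans (*-cong refl (^ˢ-vanish u u₀ j r r<j)) (zeroʳ _))

    θ-exp< : ∀ u M → θ (exp< (suc M) u) ≋ θ u ⊙ exp< M u
    θ-exp< u M r = begin
      ι r * Σ (suc M) (λ j → 1/! j * (u ^ˢ j) r)           ≈⟨ Σ-*ˡ (suc M) _ _ ⟩
      Σ (suc M) (λ j → ι r * (1/! j * (u ^ˢ j) r))        ≈⟨ Σ-peel M _ ⟩
      ι r * (1/! 0 * (u ^ˢ 0) r) + Σ M (λ j → ι r * (1/! (suc j) * (u ^ˢ suc j) r))
        ≈⟨ +-cong constant-term (Σ-cong M power-term) ⟩
      0# + Σ M (λ j → (θ u ⊙ (1/! j ∙ u ^ˢ j)) r)          ≈⟨ +-identityˡ _ ⟩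
      Σ M (λ j → (θ u ⊙ (1/! j ∙ u ^ˢ j)) r)               ≈⟨ ⊙-Σ (θ u) M (λ j → 1/! j ∙ u ^ˢ j) r ⟨
      (θ u ⊙ exp< M u) r                                   ∎
      where
      constant-term : ι r * (1/! 0 * (u ^ˢ 0) r) ≈ 0#
      constant-term = begin
        ι r * (1/! 0 * (u ^ˢ 0) r)  ≈⟨ solve 3 (λ A B C → A :* (B :* C) := B :* (A :* C)) refl (ι r) (1/! 0) ((u ^ˢ 0) r) ⟩
        1/! 0 * θ (u ^ˢ 0) r       ≈⟨ *-cong refl (trans (*-cong refl (^ˢ-zero u r)) (θ-δ r)) ⟩
        1/! 0 * 0#                 ≈⟨ zeroʳ _ ⟩
        0#                         ∎
      power-term : ∀ j → ι r * (1/! (suc j) * (u ^ˢ suc j) r) ≈ (θ u ⊙ (1/! j ∙ u ^ˢ j)) r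
      power-term j = begin
        ι r * (1/! (suc j) * (u ^ˢ suc j) r)
          ≈⟨ solve 3 (λ A B C → A :* (B :* C) := B :* (A :* C)) refl (ι r) (1/! (suc j)) ((u ^ˢ suc j) r) ⟩
        1/! (suc j) * θ (u ^ˢ suc j) r            ≈⟨ *-cong refl (θ-^ˢ u j r) ⟩
        1/! (suc j) * (ι (suc j) * (θ u ⊙ u ^ˢ j) r)
          ≈⟨ solve 3 (λ A B C → A :* (B :* C) := (B :* A) :* C) refl (1/! (suc j)) (ι (suc j)) ((θ u ⊙ u ^ˢ j) r) ⟩
        ι (suc j) * 1/! (suc j) * (θ u ⊙ u ^ˢ j) r  ≈⟨ *-cong (1/!-suc j) refl ⟩
        1/! j * (θ u ⊙ u ^ˢ j) r                    ≈⟨ ⊙-∙ʳ (1/! j) (θ u) (u ^ˢ j) r ⟨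
        (θ u ⊙ (1/! j ∙ u ^ˢ j)) r                 ∎

    θ-exp : ∀ u → u 0 ≈ 0# → θ (exp u) ≋ θ u ⊙ exp u
    θ-exp u u₀ m = begin
      ι m * exp u m             ≈⟨ *-cong refl (exp-truncate u u₀ (suc m) m ℕₚ.≤-refl) ⟩
      θ (exp< (suc m) u) m      ≈⟨ θ-exp< u m m ⟩
      (θ u ⊙ exp< m u) m        ≈⟨ ⊙-agree-below (θ u) m (zeroˡ _) (λ r r<m → exp-truncate u u₀ m r r<m) ⟨
      (θ u ⊙ exp u) m           ∎

    te^t : Ser
    te^t zero    = 0#
    te^t (suc m) = 1/! m

    θ-∙expm1 : ∀ x → θ (x ∙ expm1 R F) ≋ x ∙ te^t
    θ-∙expm1 x zero    = trans (zeroˡ _) (sym (zeroʳ x))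
    θ-∙expm1 x (suc m) = begin
      ι (suc m) * (x * 1/! (suc m))  ≈⟨ solve 3 (λ A B C → A :* (B :* C) := B :* (A :* C)) refl (ι (suc m)) x (1/! (suc m)) ⟩
      x * (ι (suc m) * 1/! (suc m))  ≈⟨ *-cong refl (1/!-suc m) ⟩
      x * 1/! m                      ∎

    θ-exp-∙expm1 : ∀ x → θ (exp (x ∙ expm1 R F)) ≋ (x ∙ te^t) ⊙ exp (x ∙ expm1 R F)
    θ-exp-∙expm1 x = ≋-trans (θ-exp (x ∙ expm1 R F) (zeroʳ x)) (⊙-congˡ (exp (x ∙ expm1 R F)) (θ-∙expm1 x))

    e^ : Carrier → Ser
    e^ x r = 1/! r * x ^ r

    e^-cong : ∀ {x y} → x ≈ y → e^ x ≋ e^ y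
    e^-cong x≈y r = *-cong refl (^-cong r x≈y)

    e^-constant : ∀ x → e^ x 0 ≈ 1#
    e^-constant x = trans (*-identityʳ _) 1/!-zero

    e^-zero : e^ 0# ≋ δ
    e^-zero zero    = e^-constant 0#
    e^-zero (suc r) = trans (*-cong refl (zeroˡ _)) (zeroʳ _)

    e^-one : ∀ r → e^ (ι 1) r ≈ 1/! r
    e^-one r = trans (*-cong refl (trans (^-cong r ι-1) (1^ r))) (*-identityʳ _)

    !*e^ : ∀ x r → ι (r !) * e^ x r ≈ x ^ r
    !*e^ x r = trans (sym (*-assoc _ _ _)) (trans (*-cong (!*1/! r) refl) (*-identityˡ _))

    e^-⊙ : ∀ x y → e^ x ⊙ e^ y ≋ e^ (x + y)
    e^-⊙ x y r = begin
      Σ (suc r) (λ i → 1/! i * x ^ i * (1/! (r ∸ i) * y ^ (r ∸ i)))  ≈⟨ Σ-cong-< (suc r) term ⟩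
      Σ (suc r) (λ i → 1/! r * (ι (r C i) * x ^ i * y ^ (r ∸ i)))     ≈⟨ Σ-*ˡ (suc r) _ _ ⟨
      1/! r * Σ (suc r) (λ i → ι (r C i) * x ^ i * y ^ (r ∸ i))       ≈⟨ *-cong refl (binomial r x y) ⟨
      1/! r * (x + y) ^ r                                            ∎
      where
      term : ∀ i → i < suc r → 1/! i * x ^ i * (1/! (r ∸ i) * y ^ (r ∸ i)) ≈ 1/! r * (ι (r C i) * x ^ i * y ^ (r ∸ i))
      term i i<1+r = sym (begin
        1/! r * (ι (r C i) * x ^ i * y ^ (r ∸ i))
          ≈⟨ *-cong refl (*-cong (*-cong (C-factorials (ℕₚ.≤-pred i<1+r)) refl) refl) ⟩
        1/! r * (ι (r !) * 1/! i * 1/! (r ∸ i) * x ^ i * y ^ (r ∸ i))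
          ≈⟨ solve 6 (λ Q F I J X Y → Q :* (F :* I :* J :* X :* Y) := (F :* Q) :* (I :* X :* (J :* Y))) refl
               (1/! r) (ι (r !)) (1/! i) (1/! (r ∸ i)) (x ^ i) (y ^ (r ∸ i)) ⟩
        ι (r !) * 1/! r * (1/! i * x ^ i * (1/! (r ∸ i) * y ^ (r ∸ i)))
          ≈⟨ trans (*-cong (!*1/! r) refl) (*-identityˡ _) ⟩
        1/! i * x ^ i * (1/! (r ∸ i) * y ^ (r ∸ i))  ∎)

    1-e^t : Ser
    1-e^t = (- 1#) ∙ expm1 R F

    1-e^t-split : 1-e^t ≋ e^ (ι 0) ⊕ (- 1#) ∙ e^ (ι 1)
    1-e^t-split zero = sym (begin
      e^ (ι 0) 0 + - 1# * e^ (ι 1) 0  ≈⟨ +-cong (e^-constant (ι 0)) (*-cong refl (e^-constant (ι 1))) ⟩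
      1# + - 1# * 1#                  ≈⟨ +-cong refl (*-identityʳ _) ⟩
      1# + - 1#                       ≈⟨ -‿inverseʳ 1# ⟩
      0#                              ≈⟨ zeroʳ _ ⟨
      - 1# * 0#                       ∎)
    1-e^t-split (suc m) = sym (begin
      e^ (ι 0) (suc m) + - 1# * e^ (ι 1) (suc m)  ≈⟨ +-cong (e^-zero (suc m)) (*-cong refl (e^-one (suc m))) ⟩
      0# + - 1# * 1/! (suc m)                     ≈⟨ +-identityˡ _ ⟩
      - 1# * 1/! (suc m)                          ∎)

    1-e^t-⊙ : ∀ j → 1-e^t ⊙ e^ (ι j) ≋ e^ (ι j) ⊕ (- 1#) ∙ e^ (ι (suc j))
    1-e^t-⊙ j r = begin
      (1-e^t ⊙ e^ (ι j)) r
        ≈⟨ ⊙-congˡ (e^ (ι j)) 1-e^t-split r ⟩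
      ((e^ (ι 0) ⊕ (- 1#) ∙ e^ (ι 1)) ⊙ e^ (ι j)) r
        ≈⟨ ⊙-distribʳ (e^ (ι 0)) ((- 1#) ∙ e^ (ι 1)) (e^ (ι j)) r ⟩
      (e^ (ι 0) ⊙ e^ (ι j)) r + ((- 1#) ∙ e^ (ι 1) ⊙ e^ (ι j)) r
        ≈⟨ +-cong (trans (⊙-congˡ (e^ (ι j)) e^-zero r) (δ-unitˡ (e^ (ι j)) r))
                  (trans (⊙-∙ˡ (- 1#) (e^ (ι 1)) (e^ (ι j)) r)
                         (*-cong refl (trans (e^-⊙ (ι 1) (ι j) r) (e^-cong (sym (ι-+ 1 j)) r)))) ⟩
      e^ (ι j) r + - 1# * e^ (ι (suc j)) r  ∎

    1-e^t-^ˢ : ∀ k → 1-e^t ^ˢ k ≋ (λ r → Σ (suc k) (λ j → (- 1#) ^ j * ι (k C j) * e^ (ι j) r))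
    1-e^t-^ˢ zero r = sym (begin
      0# + 1# * ι 1 * e^ (ι 0) r  ≈⟨ +-identityˡ _ ⟩
      1# * ι 1 * e^ (ι 0) r       ≈⟨ trans (*-cong (trans (*-identityˡ _) ι-1) refl) (*-identityˡ _) ⟩
      e^ (ι 0) r                  ≈⟨ e^-zero r ⟩
      δ r                         ≈⟨ ^ˢ-zero 1-e^t r ⟨
      (1-e^t ^ˢ 0) r              ∎)
    1-e^t-^ˢ (suc k) r = begin
      (1-e^t ⊙ 1-e^t ^ˢ k) r
        ≈⟨ ⊙-congʳ 1-e^t {v′ = λ r → Σ (suc k) (λ j → (((- 1#) ^ j * ι (k C j)) ∙ e^ (ι j)) r)} (1-e^t-^ˢ k) r ⟩
      (1-e^t ⊙ (λ r → Σ (suc k) (λ j → (((- 1#) ^ j * ι (k C j)) ∙ e^ (ι j)) r))) r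
        ≈⟨ ⊙-Σ 1-e^t (suc k) (λ j → ((- 1#) ^ j * ι (k C j)) ∙ e^ (ι j)) r ⟩
      Σ (suc k) (λ j → (1-e^t ⊙ (((- 1#) ^ j * ι (k C j)) ∙ e^ (ι j))) r)
        ≈⟨ Σ-cong (suc k) (λ j → trans (⊙-∙ʳ _ 1-e^t (e^ (ι j)) r) (*-cong refl (1-e^t-⊙ j r))) ⟩
      Σ (suc k) (λ j → ((- 1#) ^ j * ι (k C j)) * (e^ (ι j) r + - 1# * e^ (ι (suc j)) r))
        ≈⟨ Σ-cong (suc k) (λ j → solve 5 (λ S C E E′ M → (S :* C) :* (E :+ M :* E′) := C :* (S :* E) :+ C :* ((M :* S) :* E′))
                                        refl ((- 1#) ^ j) (ι (k C j)) (e^ (ι j) r) (e^ (ι (suc j)) r) (- 1#)) ⟩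
      Σ (suc k) (λ j → ι (k C j) * G j + ι (k C j) * G (suc j))
        ≈⟨ Σ-+ (suc k) _ _ ⟩
      Σ (suc k) (λ j → ι (k C j) * G j) + Σ (suc k) (λ j → ι (k C j) * G (suc j))
        ≈⟨ Σ-pascal k G ⟨
      Σ (suc (suc k)) (λ j → ι (suc k C j) * G j)
        ≈⟨ Σ-cong (suc (suc k)) (λ j → solve 3 (λ C S E → C :* (S :* E) := S :* C :* E) refl (ι (suc k C j)) ((- 1#) ^ j) (e^ (ι j) r)) ⟩
      Σ (suc (suc k)) (λ j → (- 1#) ^ j * ι (suc k C j) * e^ (ι j) r) ∎
      where
      G : ℕ → Carrier
      G j = (- 1#) ^ j * e^ (ι j) r

    -- The candidate coefficients of p_{N+1} given by the transfer formula
    -- p_{N+1}(x) = x B(t) x^N:  q_0 = 0 and q_{i+1} = N!/i! · B_{N-i}.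
    transfer-coeff : ℕ → Ser → ℕ → Carrier
    transfer-coeff N B zero    = 0#
    transfer-coeff N B (suc i) = ι (N !) * 1/! i * B (N ∸ i)

    pairing-transfer : ∀ N B w → pairing (suc N) (transfer-coeff N B) w ≈ ι (N !) * (θ w ⊙ B) (suc N)
    pairing-transfer N B w = trans (Σ-cong (suc (suc N)) term) (sym (Σ-*ˡ (suc (suc N)) _ _))
      where
      term : ∀ i → transfer-coeff N B i * (ι (i !) * w i) ≈ ι (N !) * (θ w i * B (suc N ∸ i))
      term zero    = trans (zeroˡ _) (sym (trans (*-cong refl (trans (*-cong (zeroˡ _) refl) (zeroˡ _))) (zeroʳ _)))
      term (suc i) = begin
        ι (N !) * 1/! i * B (N ∸ i) * (ι (suc i !) * w (suc i))
          ≈⟨ *-cong refl (*-cong (ι-* (suc i) (i !)) refl) ⟩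
        ι (N !) * 1/! i * B (N ∸ i) * (ι (suc i) * ι (i !) * w (suc i))
          ≈⟨ solve 6 (λ A I Bv S F′ W → A :* I :* Bv :* (S :* F′ :* W) := A :* ((F′ :* I) :* ((S :* W) :* Bv))) refl
               (ι (N !)) (1/! i) (B (N ∸ i)) (ι (suc i)) (ι (i !)) (w (suc i)) ⟩
        ι (N !) * ((ι (i !) * 1/! i) * (θ w (suc i) * B (N ∸ i)))
          ≈⟨ *-cong refl (trans (*-cong (!*1/! i) refl) (*-identityˡ _)) ⟩
        ι (N !) * (θ w (suc i) * B (N ∸ i))        ∎

    module Associated (c : Carrier) where

      f : Ser
      f = fSeries R F c

      E : Ser
      E = exp (c ∙ expm1 R F)

      α : Ser
      α = c ∙ te^t

      θ-f : θ f ≋ (δ ⊕ α) ⊙ f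
      θ-f = ≋-trans (θ-t· E) (≋-trans (t·-cong {E ⊕ θ E} {(δ ⊕ α) ⊙ E} E+θE) (≋-sym (⊙-t· (δ ⊕ α) E)))
        where
        E+θE : E ⊕ θ E ≋ (δ ⊕ α) ⊙ E
        E+θE m = trans (+-cong (sym (δ-unitˡ E m)) (θ-exp-∙expm1 c m)) (sym (⊙-distribʳ δ α E m))

      -- f is a delta series normalised by [t] f = 1, so its powers are triangular.
      fᵏ-vanish : ∀ k r → r < k → (f ^ˢ k) r ≈ 0#
      fᵏ-vanish = ^ˢ-vanish f refl

      fᵏ-leading : ∀ k → (f ^ˢ k) k ≈ 1#
      fᵏ-leading = ^ˢ-leading f refl (exp-zero (c ∙ expm1 R F))

      module Degree (N : ℕ) where
        n : ℕ
        n = suc N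

        -- B = E^{-n} = exp (-n c (e^t - 1))
        B : Ser
        B = exp ((- (ι n * c)) ∙ expm1 R F)

        θ-B : θ B ≋ (- ι n) ∙ (α ⊙ B)
        θ-B m = begin
          θ B m                         ≈⟨ θ-exp-∙expm1 (- (ι n * c)) m ⟩
          (((- (ι n * c)) ∙ te^t) ⊙ B) m  ≈⟨ ⊙-cong {v = B} {v′ = B} rescale (λ _ → refl) m ⟩
          (((- ι n) ∙ α) ⊙ B) m         ≈⟨ ⊙-∙ˡ (- ι n) α B m ⟩
          - ι n * (α ⊙ B) m             ∎
          where
          rescale : (- (ι n * c)) ∙ te^t ≋ (- ι n) ∙ α
          rescale r = trans (*-cong (-‿distribˡ-* (ι n) c) refl) (*-assoc _ _ _)

        P : ℕ → Ser
        P k = f ^ˢ k ⊙ B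

        θ-P : ∀ k → θ (P k) ≋ ι k ∙ ((δ ⊕ α) ⊙ P k) ⊕ (- ι n) ∙ (α ⊙ P k)
        θ-P k m = begin
          θ (f ^ˢ k ⊙ B) m                                  ≈⟨ θ-⊙ (f ^ˢ k) B m ⟩
          (θ (f ^ˢ k) ⊙ B) m + (f ^ˢ k ⊙ θ B) m
            ≈⟨ +-cong (⊙-congˡ B (θ-^ˢ-eigen f (δ ⊕ α) θ-f k) m)
                      (⊙-congʳ (f ^ˢ k) {v′ = (- ι n) ∙ (α ⊙ B)} θ-B m) ⟩
          ((ι k ∙ ((δ ⊕ α) ⊙ f ^ˢ k)) ⊙ B) m + (f ^ˢ k ⊙ (- ι n) ∙ (α ⊙ B)) m
            ≈⟨ +-cong (trans (⊙-∙ˡ (ι k) ((δ ⊕ α) ⊙ f ^ˢ k) B m) (*-cong refl (⊙-assoc (δ ⊕ α) (f ^ˢ k) B m)))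
                      (trans (⊙-∙ʳ (- ι n) (f ^ˢ k) (α ⊙ B) m) (*-cong refl (⊙-lcomm (f ^ˢ k) α B m))) ⟩
          ι k * ((δ ⊕ α) ⊙ P k) m + - ι n * (α ⊙ P k) m      ∎

        X : ℕ → Carrier
        X k = ((δ ⊕ α) ⊙ P k) n

        X-off-diagonal : ∀ k → n ≢ k → X k ≈ 0#
        X-off-diagonal k n≢k = distinct-multiples n k (X k) n≢k (θ-balance α (P k) k n (θ-P k))

        X-diagonal : X n ≈ 1#
        X-diagonal = begin
          ((δ ⊕ α) ⊙ P n) n   ≈⟨ ⊙-comm (δ ⊕ α) (P n) n ⟩
          (P n ⊙ (δ ⊕ α)) n   ≈⟨ ⊙-lowest (P n) (δ ⊕ α) n (⊙-vanish (f ^ˢ n) B n (fᵏ-vanish n)) ⟩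
          P n n * (1# + c * 0#)  ≈⟨ *-cong (⊙-lowest (f ^ˢ n) B n (fᵏ-vanish n)) (trans (+-cong refl (zeroʳ c)) (+-identityʳ 1#)) ⟩
          (f ^ˢ n) n * B 0 * 1#  ≈⟨ *-identityʳ _ ⟩
          (f ^ˢ n) n * B 0       ≈⟨ *-cong (fᵏ-leading n) (exp-zero ((- (ι n * c)) ∙ expm1 R F)) ⟩
          1# * 1#               ≈⟨ *-identityˡ 1# ⟩
          1#                    ∎

        q : ℕ → Carrier
        q = transfer-coeff N B

        pairing-X : ∀ k → pairing n q (f ^ˢ k) ≈ ι (N !) * (ι k * X k)
        pairing-X k = begin
          pairing n q (f ^ˢ k)                   ≈⟨ pairing-transfer N B (f ^ˢ k) ⟩
          ι (N !) * (θ (f ^ˢ k) ⊙ B) n           ≈⟨ *-cong refl (⊙-congˡ B (θ-^ˢ-eigen f (δ ⊕ α) θ-f k) n) ⟩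
          ι (N !) * ((ι k ∙ ((δ ⊕ α) ⊙ f ^ˢ k)) ⊙ B) n  ≈⟨ *-cong refl (⊙-∙ˡ (ι k) _ B n) ⟩
          ι (N !) * (ι k * (((δ ⊕ α) ⊙ f ^ˢ k) ⊙ B) n)  ≈⟨ *-cong refl (*-cong refl (⊙-assoc (δ ⊕ α) (f ^ˢ k) B n)) ⟩
          ι (N !) * (ι k * X k)                  ∎

        pairing-q : ∀ k → pairing n q (f ^ˢ k) ≈ n!δ R n k
        pairing-q k with n ℕ.≟ k
        ... | yes ≡.refl = begin
          pairing n q (f ^ˢ n)  ≈⟨ pairing-X n ⟩
          ι (N !) * (ι n * X n)  ≈⟨ *-cong refl (trans (*-cong refl X-diagonal) (*-identityʳ _)) ⟩
          ι (N !) * ι n          ≈⟨ *-comm _ _ ⟩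
          ι n * ι (N !)          ≈⟨ ι-* n (N !) ⟨
          ι (n !)                ∎
        ... | no n≢k = begin
          pairing n q (f ^ˢ k)  ≈⟨ pairing-X k ⟩
          ι (N !) * (ι k * X k)  ≈⟨ *-cong refl (*-cong refl (X-off-diagonal k n≢k)) ⟩
          ι (N !) * (ι k * 0#)   ≈⟨ trans (*-cong refl (zeroʳ _)) (zeroʳ _) ⟩
          0#                     ∎

        -- The coefficients of B up to degree N, via B = Σ_k νᵏ (1 - e^t)ᵏ / k!
        -- with ν = n c, as a combination of exponentials e^{jt}.
        ν : Carrier
        ν = ι n * c

        weight : ℕ → ℕ → Carrier
        weight k j = (- 1#) ^ j * ν ^ k * 1/! k * ι (k C j)

        B≤N : Ser
        B≤N r = Σ (suc N) (λ k → Σ (suc k) (λ j → weight k j * e^ (ι j) r))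

        B-explicit : ∀ r → r ≤ N → B r ≈ B≤N r
        B-explicit r r≤N = trans (exp-truncate u (zeroʳ _) (suc N) r (s≤s r≤N)) (Σ-cong (suc N) term)
          where
          u : Ser
          u = (- ν) ∙ expm1 R F
          rescale : u ≋ ν ∙ 1-e^t
          rescale m = trans (sym (-‿distribˡ-* ν _)) (trans (-‿distribʳ-* ν _) (*-cong refl (sym (-1*x≈-x _))))
          term : ∀ k → 1/! k * (u ^ˢ k) r ≈ Σ (suc k) (λ j → weight k j * e^ (ι j) r)
          term k = begin
            1/! k * (u ^ˢ k) r                  ≈⟨ *-cong refl (^ˢ-cong k rescale r) ⟩
            1/! k * ((ν ∙ 1-e^t) ^ˢ k) r        ≈⟨ *-cong refl (^ˢ-∙ ν 1-e^t k r) ⟩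
            1/! k * (ν ^ k * (1-e^t ^ˢ k) r)    ≈⟨ *-cong refl (*-cong refl (1-e^t-^ˢ k r)) ⟩
            1/! k * (ν ^ k * Σ (suc k) (λ j → (- 1#) ^ j * ι (k C j) * e^ (ι j) r))
              ≈⟨ trans (*-cong refl (Σ-*ˡ (suc k) _ _)) (Σ-*ˡ (suc k) _ _) ⟩
            Σ (suc k) (λ j → 1/! k * (ν ^ k * ((- 1#) ^ j * ι (k C j) * e^ (ι j) r)))
              ≈⟨ Σ-cong (suc k) (λ j → solve 5 (λ I V S C E → I :* (V :* (S :* C :* E)) := S :* V :* I :* C :* E) refl
                                          (1/! k) (ν ^ k) ((- 1#) ^ j) (ι (k C j)) (e^ (ι j) r)) ⟩
            Σ (suc k) (λ j → weight k j * e^ (ι j) r) ∎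

        transfer-sum : ∀ x → ι (N !) * (e^ x ⊙ B) N ≈ Σ (suc N) (λ k → Σ (suc k) (λ j → weight k j * (x + ι j) ^ N))
        transfer-sum x = begin
          ι (N !) * (e^ x ⊙ B) N
            ≈⟨ *-cong refl (⊙-agree-upto (e^ x) N B-explicit) ⟩
          ι (N !) * (e^ x ⊙ B≤N) N
            ≈⟨ *-cong refl (⊙-Σ (e^ x) (suc N) (λ k r → Σ (suc k) (λ j → (weight k j ∙ e^ (ι j)) r)) N) ⟩
          ι (N !) * Σ (suc N) (λ k → (e^ x ⊙ (λ r → Σ (suc k) (λ j → (weight k j ∙ e^ (ι j)) r))) N)
            ≈⟨ *-cong refl (Σ-cong (suc N) (λ k → ⊙-Σ (e^ x) (suc k) (λ j → weight k j ∙ e^ (ι j)) N)) ⟩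
          ι (N !) * Σ (suc N) (λ k → Σ (suc k) (λ j → (e^ x ⊙ (weight k j ∙ e^ (ι j))) N))
            ≈⟨ Σ-*ˡ (suc N) _ _ ⟩
          Σ (suc N) (λ k → ι (N !) * Σ (suc k) (λ j → (e^ x ⊙ (weight k j ∙ e^ (ι j))) N))
            ≈⟨ Σ-cong (suc N) (λ k → trans (Σ-*ˡ (suc k) _ _) (Σ-cong (suc k) (term k))) ⟩
          Σ (suc N) (λ k → Σ (suc k) (λ j → weight k j * (x + ι j) ^ N)) ∎
          where
          term : ∀ k j → ι (N !) * (e^ x ⊙ (weight k j ∙ e^ (ι j))) N ≈ weight k j * (x + ι j) ^ N
          term k j = begin
            ι (N !) * (e^ x ⊙ (weight k j ∙ e^ (ι j))) N   ≈⟨ *-cong refl (⊙-∙ʳ (weight k j) (e^ x) (e^ (ι j)) N) ⟩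
            ι (N !) * (weight k j * (e^ x ⊙ e^ (ι j)) N)   ≈⟨ *-cong refl (*-cong refl (e^-⊙ x (ι j) N)) ⟩
            ι (N !) * (weight k j * e^ (x + ι j) N)        ≈⟨ solve 3 (λ F W E → F :* (W :* E) := W :* (F :* E)) refl _ _ _ ⟩
            weight k j * (ι (N !) * e^ (x + ι j) N)        ≈⟨ *-cong refl (!*e^ (x + ι j) N) ⟩
            weight k j * (x + ι j) ^ N                      ∎

        -- Evaluating the transfer coefficients: q(x) = x · N! [t^N] (e^{xt} B).
        eval-q : ∀ x → Σ (suc n) (λ i → q i * x ^ i) ≈ rhs R F c n x
        eval-q x = begin
          Σ (suc n) (λ i → q i * x ^ i)                              ≈⟨ Σ-peel n _ ⟩
          0# * 1# + Σ n (λ i → q (suc i) * (x * x ^ i))              ≈⟨ +-cong (zeroˡ _) (Σ-cong n term) ⟩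
          0# + Σ n (λ i → x * (ι (N !) * (e^ x i * B (N ∸ i))))     ≈⟨ +-identityˡ _ ⟩
          Σ n (λ i → x * (ι (N !) * (e^ x i * B (N ∸ i))))          ≈⟨ trans (*-cong refl (Σ-*ˡ n _ _)) (Σ-*ˡ n x _) ⟨
          x * (ι (N !) * (e^ x ⊙ B) N)                               ≈⟨ *-cong refl (transfer-sum x) ⟩
          rhs R F c n x                                              ∎
          where
          term : ∀ i → q (suc i) * (x * x ^ i) ≈ x * (ι (N !) * (e^ x i * B (N ∸ i)))
          term i = solve 5 (λ F I Bv X P → F :* I :* Bv :* (X :* P) := X :* (F :* (I :* P :* Bv))) refl
                     (ι (N !)) (1/! i) (B (N ∸ i)) x (x ^ i)

lemma2 : ∀ {a ℓ : Level} (R : CommutativeRing a ℓ) (F : CharZeroField R)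
           (c : CommutativeRing.Carrier R) → ¬ (CommutativeRing._≈_ R c (CommutativeRing.0# R))
           → (p : (n : ℕ) → Poly≤ R n) → IsAssociatedSequence R (fSeries R F c) p
           → (n : ℕ) → 1 ≤ n → (x : CommutativeRing.Carrier R)
           → CommutativeRing._≈_ R (evalP R (p n) x) (rhs R F c n x)
lemma2 R F c _ p (_ , p-pairings) (suc N) (s≤s z≤n) x = begin
  evalP R (p n) x                           ≈⟨ evalP-coeff (p n) x ⟩
  Σ (suc n) (λ i → coeff (p n) i * x ^ i)   ≈⟨ Σ-cong-< (suc n) (λ i i<1+n → *-cong (coeff-p i (ℕₚ.≤-pred i<1+n)) refl) ⟩
  Σ (suc n) (λ i → q i * x ^ i)             ≈⟨ eval-q x ⟩
  rhs R F c n x                             ∎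
  where
  open CommutativeRing R
  open import Relation.Binary.Reasoning.Setoid setoid
  open Theory R
  open Associated F c
  open Degree N
  -- p_n and q have the same pairings with all powers of f, hence the same coefficients.
  coeff-p : ∀ i → i ≤ n → coeff (p n) i ≈ q i
  coeff-p = triangular-unique F (f ^ˢ_) fᵏ-vanish fᵏ-leading n (coeff (p n)) q
    (λ k _ → trans (sym (⟨∣⟩-coeff (f ^ˢ k) (p n))) (trans (p-pairings n k) (sym (pairing-q k))))
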